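{- Let $G=(V,E)$ be a finite simple graph and let $S\subseteq V$ be a local maximum stable set of $G$. Let $H=G[N[S]]$ be the subgraph induced by $N[S]=S\cup N(S)$, and suppose $H$ is a K\"{o}nig-Egerv\'{a}ry graph. If $M$ is a maximum matching in $H$, then there exists a maximum matching $M_0$ of $G$ with $M\subseteq M_0$.
   Context: All graphs are finite, simple. For $A\subseteq V$, $N(A)=\{v\in V-A : N(v)\cap A\neq\emptyset\}$ and $N[A]=A\cup N(A)$. A stable set is a set of pairwise non-adjacent vertices; $\alpha(G)$ is the maximum cardinality of a stable set. A set $A\subseteq V(G)$ is a local maximum stable set of $G$ if $A$ is a maximum stable set of the induced subgraph $G[N[A]]$. $\mu(G)$ denotes the size of a maximum matching of $G$. $G$ is a K\"{o}nig-Egerv\'{a}ry graph if $\alpha(G)+\mu(G)=|V(G)|$. -}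

module Defs where

open import Data.Nat using (ℕ; _≤_; _+_)
open import Data.Bool using (Bool; true; false; _∧_; _∨_)
open import Data.Fin using (Fin)
open import Data.Fin.Subset using (Subset; _∈_; _⊆_; ∣_∣; ⊤)
open import Data.Vec using (lookup; tabulate)
open import Data.List using (List; []; _∷_; concatMap; length; allFin)
open import Data.Bool.ListAction using (any)
open import Data.List.Relation.Unary.All using (All)
open import Data.List.Relation.Unary.Unique.Propositional using (Unique)
import Data.List.Membership.Propositional as L
open import Data.Product using (_×_; _,_; Σ; ∃)
open import Data.Sum using (_⊎_)
open import Relation.Binary.PropositionalEquality using (_≡_)

record Graph (n : ℕ) : Set where
  field
    adj   : Fin n → Fin n → Bool
    sym   : ∀ u v → adj u v ≡ adj v u
    irrefl : ∀ v → adj v v ≡ false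
open Graph public

module _ {n : ℕ} (G : Graph n) where

  closedNbhd : Subset n → Subset n
  closedNbhd A = tabulate (λ v → lookup A v ∨ any (λ u → lookup A u ∧ adj G u v) (allFin n))

  IsStable : Subset n → Set
  IsStable A = ∀ u v → u ∈ A → v ∈ A → adj G u v ≡ false

  IsMaxStableIn : Subset n → Subset n → Set
  IsMaxStableIn X A = A ⊆ X × IsStable A × (∀ B → B ⊆ X → IsStable B → ∣ B ∣ ≤ ∣ A ∣)

  IsLocalMaxStable : Subset n → Set
  IsLocalMaxStable A = IsMaxStableIn (closedNbhd A) A

  -- Matchings: lists of edges (u , v); size = length.
  endpoints : List (Fin n × Fin n) → List (Fin n)
  endpoints = concatMap (λ { (u , v) → u ∷ v ∷ [] })

  IsMatchingIn : Subset n → List (Fin n × Fin n) → Set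
  IsMatchingIn X M =
    All (λ { (u , v) → adj G u v ≡ true × u ∈ X × v ∈ X }) M × Unique (endpoints M)

  IsMaxMatchingIn : Subset n → List (Fin n × Fin n) → Set
  IsMaxMatchingIn X M =
    IsMatchingIn X M × (∀ M′ → IsMatchingIn X M′ → length M′ ≤ length M)

  IsKEIn : Subset n → Set
  IsKEIn X = Σ (Subset n) λ A → Σ (List (Fin n × Fin n)) λ M →
    IsMaxStableIn X A × IsMaxMatchingIn X M × ∣ A ∣ + length M ≡ ∣ X ∣

  -- edge-set inclusion M ⊆ M₀ (edges are unordered pairs)
  EdgeSubset : List (Fin n × Fin n) → List (Fin n × Fin n) → Set
  EdgeSubset M M₀ = ∀ u v → (u , v) L.∈ M → ((u , v) L.∈ M₀ ⊎ (v , u) L.∈ M₀)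

-- Let T = N[S] and fix a maximum matching M* of G. Each edge of M* meeting T
-- has an endpoint in T ∖ S: an edge cannot join two vertices of the stable
-- set S, and a neighbour of S lies in T. These endpoints are distinct, so at
-- most |T| − |S| = |T| − α(H) = μ(H) = |M| edges of M* meet T. The edges of
-- M* avoiding T are disjoint from M, hence M together with them is a matching
-- of G containing M with at least |M*| edges.
module Submission where

open import Defs
open import Data.Nat using (ℕ)
open import Data.Fin using (Fin)
open import Data.Fin.Subset using (Subset; ⊤)
open import Data.List using (List)
open import Data.Product using (_×_; Σ)

open import Level using (0ℓ)
open import Function using (_∘_; Equivalence)
open import Data.Nat using (zero; suc; _+_; _≤_; s≤s)
open import Data.Nat.Properties
  using (≤-trans; +-suc; +-comm; +-mono-≤; +-monoˡ-≤; +-cancelʳ-≤; m≤m+n; module ≤-Reasoning)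
open import Data.Bool using (true; T; _∧_)
import Data.Bool as Bool
open import Data.Bool.ListAction using (any)
open import Data.Bool.Properties using (T-≡; T-∧; T-∨)
open import Data.Fin using (_≟_)
open import Data.Fin.Subset using (_∈_; _∉_; _⊆_; ∣_∣; ⊥; _-_; ⁅_⁆)
open import Data.Fin.Subset.Properties
  using (_∈?_; ∈⊤; ∉⊥; ⊆⊤; ∣⊤∣≡n; p⊆q⇒∣p∣≤∣q∣; x∈p⇒∣p-x∣<∣p∣; x∈p∧x∉q⇒x∈p─q; x∈⁅y⁆⇒x≡y)
open import Data.List
  using ([]; _∷_; _++_; length; filter; allFin; cartesianProduct; cartesianProductWith)
open import Data.List.Properties using (length-++; concatMap-++)
open import Data.List.Relation.Unary.All as All using (All; []; _∷_)
open import Data.List.Relation.Unary.All.Properties using (all-filter; ++⁺)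
open import Data.List.Relation.Unary.AllPairs using (AllPairs; []; _∷_)
open import Data.List.Relation.Unary.Any using (here; there)
open import Data.List.Relation.Unary.Any.Properties using (any⁺)
open import Data.List.Relation.Unary.Unique.Propositional using (Unique)
import Data.List.Relation.Unary.Unique.Propositional.Properties as Unique
open import Data.List.Relation.Unary.Unique.DecPropositional using (unique?)
open import Data.List.Relation.Binary.Sublist.Propositional
  using ([]; _∷_; _∷ʳ_) renaming (_⊆_ to _⊑_)
open import Data.List.Relation.Binary.Sublist.Propositional.Properties using (All-resp-⊆; filter-⊆)
import Data.List.Membership.Propositional as List
open import Data.List.Membership.Propositional using (lose)
open import Data.List.Membership.Propositional.Properties
  using (∈-allFin; ∈-cartesianProduct⁺; ∈-cartesianProductWith⁺; ∈-filter⁺; ∈-++⁺ˡ)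
open import Data.List.Extrema.Nat using (argmax; argmax-all; f[xs]≤f[argmax])
open import Data.Product using (_,_; proj₁; proj₂; ∃)
open import Data.Sum as Sum using (_⊎_; inj₁; inj₂)
open import Data.Vec using (lookup)
open import Data.Vec.Properties using (lookup∘tabulate; lookup⇒[]=; []=⇒lookup)
open import Relation.Binary.PropositionalEquality using (_≡_; _≢_; refl; trans; cong; subst) renaming (sym to ≡-sym)
open import Relation.Nullary using (yes; no; ¬_; ¬?)
open import Relation.Nullary.Decidable using (_×-dec_; _⊎-dec_)
open import Relation.Unary using (Pred; Decidable)

AllPairs-resp-⊑ : ∀ {A : Set} {R : A → A → Set} {xs ys : List A} →
                  xs ⊑ ys → AllPairs R ys → AllPairs R xs
AllPairs-resp-⊑ []         []            = []
AllPairs-resp-⊑ (_ ∷ʳ xs⊑) (_ ∷ pairs)   = AllPairs-resp-⊑ xs⊑ pairs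
AllPairs-resp-⊑ (refl ∷ xs⊑) (x∼ ∷ pairs) = All-resp-⊆ xs⊑ x∼ ∷ AllPairs-resp-⊑ xs⊑ pairs

module _ {A : Set} {P : Pred A 0ℓ} (P? : Decidable P) where

  length-filter+length-filter¬ : ∀ xs → length (filter P? xs) + length (filter (¬? ∘ P?) xs) ≡ length xs
  length-filter+length-filter¬ []       = refl
  length-filter+length-filter¬ (x ∷ xs) with P? x
  ... | yes _ = cong suc (length-filter+length-filter¬ xs)
  ... | no  _ = trans (+-suc _ _) (cong suc (length-filter+length-filter¬ xs))

  length≤length-++-filter¬ : ∀ xs ys → length (filter P? xs) ≤ length ys →
                             length xs ≤ length (ys ++ filter (¬? ∘ P?) xs)
  length≤length-++-filter¬ xs ys filter≤ys = begin
    length xs                                                ≡⟨ length-filter+length-filter¬ xs ⟨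
    length (filter P? xs) + length (filter (¬? ∘ P?) xs)     ≤⟨ +-monoˡ-≤ _ filter≤ys ⟩
    length ys + length (filter (¬? ∘ P?) xs)                 ≡⟨ length-++ ys ⟨
    length (ys ++ filter (¬? ∘ P?) xs)                       ∎
    where open ≤-Reasoning

module _ {A : Set} (univ : List A) (univ-complete : ∀ x → x List.∈ univ) where

  listsOfLength≤ : ℕ → List (List A)
  listsOfLength≤ zero    = [] ∷ []
  listsOfLength≤ (suc k) = [] ∷ cartesianProductWith _∷_ univ (listsOfLength≤ k)

  ∈-listsOfLength≤ : ∀ k xs → length xs ≤ k → xs List.∈ listsOfLength≤ k
  ∈-listsOfLength≤ zero    []       _          = here refl
  ∈-listsOfLength≤ (suc k) []       _          = here refl
  ∈-listsOfLength≤ (suc k) (x ∷ xs) (s≤s xs≤k) =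
    there (∈-cartesianProductWith⁺ _∷_ (univ-complete x) (∈-listsOfLength≤ k xs xs≤k))

  ∃-longest : ∀ {P : Pred (List A) 0ℓ} → Decidable P → P [] →
              ∀ k → (∀ {xs} → P xs → length xs ≤ k) →
              ∃ λ xs → P xs × (∀ ys → P ys → length ys ≤ length xs)
  ∃-longest {P} P? P[] k bounded = longest , P-longest , longest-max
    where
    candidates : List (List A)
    candidates = filter P? (listsOfLength≤ k)
    longest : List A
    longest = argmax length [] candidates
    P-longest : P longest
    P-longest = argmax-all length P[] (all-filter P? (listsOfLength≤ k))
    longest-max : ∀ ys → P ys → length ys ≤ length longest
    longest-max ys Pys = All.lookup (f[xs]≤f[argmax] [] candidates)
                                    (∈-filter⁺ P? (∈-listsOfLength≤ k ys (bounded Pys)) Pys)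

length+∣q∣≤∣p∣ : ∀ {n} {p q : Subset n} {xs : List (Fin n)} → Unique xs →
                 All (λ x → x ∈ p × x ∉ q) xs → q ⊆ p → length xs + ∣ q ∣ ≤ ∣ p ∣
length+∣q∣≤∣p∣ {xs = []} _ _ q⊆p = p⊆q⇒∣p∣≤∣q∣ q⊆p
length+∣q∣≤∣p∣ {p = p} {q} {x ∷ xs} (x∉xs ∷ unique) ((x∈p , x∉q) ∷ xs∈p∖q) q⊆p =
  ≤-trans (s≤s (length+∣q∣≤∣p∣ unique (All.zipWith inside (x∉xs , xs∈p∖q)) q⊆p-x))
          (x∈p⇒∣p-x∣<∣p∣ x∈p)
  where
  ∉⁅x⁆ : ∀ {y} → y ≢ x → y ∉ ⁅ x ⁆
  ∉⁅x⁆ y≢x y∈⁅x⁆ = y≢x (x∈⁅y⁆⇒x≡y _ y∈⁅x⁆)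
  inside : ∀ {y} → x ≢ y × (y ∈ p × y ∉ q) → y ∈ p - x × y ∉ q
  inside (x≢y , y∈p , y∉q) = x∈p∧x∉q⇒x∈p─q y∈p (∉⁅x⁆ (x≢y ∘ ≡-sym)) , y∉q
  q⊆p-x : q ⊆ p - x
  q⊆p-x y∈q = x∈p∧x∉q⇒x∈p─q (q⊆p y∈q) (∉⁅x⁆ λ { refl → x∉q y∈q })

Meets : ∀ {A : Set} → Pred A 0ℓ → Pred (A × A) 0ℓ
Meets P (u , v) = P u ⊎ P v

meets? : ∀ {A : Set} {P : Pred A 0ℓ} → Decidable P → Decidable (Meets P)
meets? P? (u , v) = P? u ⊎-dec P? v

Edge : ℕ → Set
Edge n = Fin n × Fin n

module _ {n : ℕ} (G : Graph n) where

  endpoints-⊑ : ∀ {es fs : List (Edge n)} → es ⊑ fs → endpoints G es ⊑ endpoints G fs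
  endpoints-⊑ []                 = []
  endpoints-⊑ ((u , v) ∷ʳ es⊑fs) = u ∷ʳ v ∷ʳ endpoints-⊑ es⊑fs
  endpoints-⊑ (refl ∷ es⊑fs)     = refl ∷ refl ∷ endpoints-⊑ es⊑fs

  All-endpoints : ∀ {P : Pred (Fin n) 0ℓ} {es : List (Edge n)} →
                  All (λ e → P (proj₁ e) × P (proj₂ e)) es → All P (endpoints G es)
  All-endpoints []                 = []
  All-endpoints ((Pu , Pv) ∷ Pes) = Pu ∷ Pv ∷ All-endpoints Pes

  choose-endpoints : ∀ {P : Pred (Fin n) 0ℓ} {es : List (Edge n)} → All (Meets P) es →
                     ∃ λ ws → ws ⊑ endpoints G es × All P ws × length ws ≡ length es
  choose-endpoints [] = [] , [] , [] , refl
  choose-endpoints {es = (u , v) ∷ _} (meets ∷ Pes) with choose-endpoints Pes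
  ... | ws , ws⊑ , Pws , len with meets
  ...   | inj₁ Pu = u ∷ ws , refl ∷ v ∷ʳ ws⊑ , Pu ∷ Pws , cong suc len
  ...   | inj₂ Pv = v ∷ ws , u ∷ʳ refl ∷ ws⊑ , Pv ∷ Pws , cong suc len

  length+∣q∣≤∣p∣-of-meeting : ∀ {p q : Subset n} {es : List (Edge n)} → Unique (endpoints G es) →
                              All (Meets (λ x → x ∈ p × x ∉ q)) es → q ⊆ p →
                              length es + ∣ q ∣ ≤ ∣ p ∣
  length+∣q∣≤∣p∣-of-meeting {p} {q} unique meets q⊆p with choose-endpoints meets
  ... | ws , ws⊑ , ws∈p∖q , |ws|≡|es| =
    subst (λ k → k + ∣ q ∣ ≤ ∣ p ∣) |ws|≡|es| (length+∣q∣≤∣p∣ (AllPairs-resp-⊑ ws⊑ unique) ws∈p∖q q⊆p)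

  IsMatchingIn? : ∀ X → Decidable (IsMatchingIn G X)
  IsMatchingIn? X es =
    All.all? (λ { (u , v) → (adj G u v Bool.≟ true) ×-dec (u ∈? X) ×-dec (v ∈? X) }) es
    ×-dec unique? _≟_ (endpoints G es)

  IsMatchingIn-⊑ : ∀ {X} {es fs : List (Edge n)} → es ⊑ fs → IsMatchingIn G X fs → IsMatchingIn G X es
  IsMatchingIn-⊑ es⊑fs (edges , unique) =
    All-resp-⊆ es⊑fs edges , AllPairs-resp-⊑ (endpoints-⊑ es⊑fs) unique

  IsMatchingIn-++ : ∀ {X} {es fs : List (Edge n)} → IsMatchingIn G X es → IsMatchingIn G X fs →
                    (∀ {v} → ¬ (v List.∈ endpoints G es × v List.∈ endpoints G fs)) →
                    IsMatchingIn G X (es ++ fs)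
  IsMatchingIn-++ {es = es} {fs} (es-edges , es-unique) (fs-edges , fs-unique) disjoint =
    ++⁺ es-edges fs-edges ,
    subst Unique (≡-sym (concatMap-++ _ es fs)) (Unique.++⁺ es-unique fs-unique disjoint)

  IsMatchingIn-⊤ : ∀ {X} {es : List (Edge n)} → IsMatchingIn G X es → IsMatchingIn G ⊤ es
  IsMatchingIn-⊤ (edges , unique) = All.map (λ { (uv , _) → uv , ∈⊤ , ∈⊤ }) edges , unique

  IsMatchingIn⇒length≤n : ∀ {X} {es : List (Edge n)} → IsMatchingIn G X es → length es ≤ n
  IsMatchingIn⇒length≤n {es = es} (_ , unique) = begin
    length es            ≤⟨ m≤m+n _ _ ⟩
    length es + ∣ ⊥ {n} ∣ ≤⟨ length+∣q∣≤∣p∣-of-meeting unique (All.universal (λ _ → inj₁ (∈⊤ , ∉⊥)) es) ⊆⊤ ⟩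
    ∣ ⊤ {n} ∣             ≡⟨ ∣⊤∣≡n n ⟩
    n                    ∎
    where open ≤-Reasoning

  ∃-maximumMatching : ∃ (IsMaxMatchingIn G ⊤)
  ∃-maximumMatching = ∃-longest (cartesianProduct (allFin n) (allFin n))
                                (λ (u , v) → ∈-cartesianProduct⁺ (∈-allFin u) (∈-allFin v))
                                (IsMatchingIn? ⊤) ([] , []) n IsMatchingIn⇒length≤n

  ∈-closedNbhd⁺ : ∀ {A : Subset n} {v} → v ∈ A ⊎ (∃ λ u → u ∈ A × adj G u v ≡ true) →
                  v ∈ closedNbhd G A
  ∈-closedNbhd⁺ {A} {v} v∈N[A] =
    lookup⇒[]= v _ (trans (lookup∘tabulate _ v)
      (Equivalence.to T-≡ (Equivalence.from T-∨ (Sum.map T[A] T[N[A]] v∈N[A]))))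
    where
    T[A] : ∀ {u} → u ∈ A → T (lookup A u)
    T[A] u∈A = Equivalence.from T-≡ ([]=⇒lookup u∈A)
    T[N[A]] : (∃ λ u → u ∈ A × adj G u v ≡ true) → T (any (λ w → lookup A w ∧ adj G w v) (allFin n))
    T[N[A]] (u , u∈A , uv) =
      any⁺ _ (lose (∈-allFin u) (Equivalence.from T-∧ (T[A] u∈A , Equivalence.from T-≡ uv)))

  ⊆-closedNbhd : ∀ {A : Subset n} → A ⊆ closedNbhd G A
  ⊆-closedNbhd v∈A = ∈-closedNbhd⁺ (inj₁ v∈A)

  adj⇒∈-closedNbhd : ∀ {A : Subset n} {u v} → u ∈ A → adj G u v ≡ true → v ∈ closedNbhd G A
  adj⇒∈-closedNbhd u∈A uv = ∈-closedNbhd⁺ (inj₂ (_ , u∈A , uv))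

  module _ {S : Subset n} (S-stable : IsStable G S) where

    private
      N[S] = closedNbhd G S
      InN[S]∖S : Pred (Fin n) 0ℓ
      InN[S]∖S x = x ∈ N[S] × x ∉ S

    edge-from-N[S]-meets-N[S]∖S : ∀ {u v} → adj G u v ≡ true → u ∈ N[S] → Meets InN[S]∖S (u , v)
    edge-from-N[S]-meets-N[S]∖S {u} {v} uv u∈N[S] with u ∈? S
    ... | no  u∉S = inj₁ (u∈N[S] , u∉S)
    ... | yes u∈S = inj₂ (adj⇒∈-closedNbhd u∈S uv , v∉S)
      where
      v∉S : v ∉ S
      v∉S v∈S with trans (≡-sym uv) (S-stable u v u∈S v∈S)
      ... | ()

    edge-meeting-N[S]-meets-N[S]∖S : ∀ {u v} → adj G u v ≡ true →
                                     Meets (_∈ N[S]) (u , v) → Meets InN[S]∖S (u , v)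
    edge-meeting-N[S]-meets-N[S]∖S uv (inj₁ u∈N[S]) = edge-from-N[S]-meets-N[S]∖S uv u∈N[S]
    edge-meeting-N[S]-meets-N[S]∖S {u} {v} uv (inj₂ v∈N[S]) =
      Sum.swap (edge-from-N[S]-meets-N[S]∖S (trans (Graph.sym G v u) uv) v∈N[S])

    length-filter-meets-N[S]≤ : ∀ {X} {es : List (Edge n)} {k} → IsMatchingIn G X es →
                                ∣ N[S] ∣ ≤ ∣ S ∣ + k → length (filter (meets? (_∈? N[S])) es) ≤ k
    length-filter-meets-N[S]≤ {X} {es} {k} es-matching |N[S]|≤|S|+k =
      +-cancelʳ-≤ ∣ S ∣ _ _ (begin
        length meeting + ∣ S ∣ ≤⟨ length+∣q∣≤∣p∣-of-meeting unique meets-N[S]∖S ⊆-closedNbhd ⟩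
        ∣ N[S] ∣              ≤⟨ |N[S]|≤|S|+k ⟩
        ∣ S ∣ + k             ≡⟨ +-comm ∣ S ∣ k ⟩
        k + ∣ S ∣             ∎)
      where
      open ≤-Reasoning
      meeting : List (Edge n)
      meeting = filter (meets? (_∈? N[S])) es
      meeting-matching : IsMatchingIn G X meeting
      meeting-matching = IsMatchingIn-⊑ (filter-⊆ _ es) es-matching
      unique : Unique (endpoints G meeting)
      unique = proj₂ meeting-matching
      meets-N[S]∖S : All (Meets InN[S]∖S) meeting
      meets-N[S]∖S = All.zipWith (λ { {_ , _} ((uv , _) , meets) → edge-meeting-N[S]-meets-N[S]∖S uv meets })
                                 (proj₁ meeting-matching , all-filter _ es)

  IsMatchingIn-++-avoiding : ∀ {X} {es fs : List (Edge n)} → IsMatchingIn G X es → IsMatchingIn G ⊤ fs →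
                             IsMatchingIn G ⊤ (es ++ filter (¬? ∘ meets? (_∈? X)) fs)
  IsMatchingIn-++-avoiding {X} {es} {fs} es-matching fs-matching =
    IsMatchingIn-++ (IsMatchingIn-⊤ es-matching) (IsMatchingIn-⊑ (filter-⊆ _ fs) fs-matching)
                    (λ (v∈es , v∈avoiding) → All.lookup outside v∈avoiding (All.lookup inside v∈es))
    where
    inside : All (_∈ X) (endpoints G es)
    inside = All-endpoints (All.map (λ { {_ , _} (_ , u∈X , v∈X) → u∈X , v∈X }) (proj₁ es-matching))
    outside : All (_∉ X) (endpoints G (filter (¬? ∘ meets? (_∈? X)) fs))
    outside = All-endpoints (All.map (λ { {_ , _} avoids → avoids ∘ inj₁ , avoids ∘ inj₂ }) (all-filter _ fs))

corollary1 : ∀ {n : ℕ} (G : Graph n) (S : Subset n) →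
    IsLocalMaxStable G S →
    IsKEIn G (closedNbhd G S) →
    (M : List (Fin n × Fin n)) →
    IsMaxMatchingIn G (closedNbhd G S) M →
    Σ (List (Fin n × Fin n)) (λ M₀ → IsMaxMatchingIn G ⊤ M₀ × EdgeSubset G M M₀)
corollary1 {n} G S (_ , S-stable , S-max) (A , M′ , (A⊆N[S] , A-stable , _) , (M′-matching , _) , |A|+|M′|≡|N[S]|)
           M (M-matching , M-max) with ∃-maximumMatching G
... | M* , M*-matching , M*-max =
  M ++ M*-outside-N[S] ,
  (IsMatchingIn-++-avoiding G M-matching M*-matching , larger) ,
  λ _ _ e∈M → inj₁ (∈-++⁺ˡ e∈M)
  where
  open ≤-Reasoning
  M*-outside-N[S] : List (Edge n)
  M*-outside-N[S] = filter (¬? ∘ meets? (_∈? closedNbhd G S)) M*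
  |N[S]|≤|S|+|M| : ∣ closedNbhd G S ∣ ≤ ∣ S ∣ + length M
  |N[S]|≤|S|+|M| = begin
    ∣ closedNbhd G S ∣ ≡⟨ |A|+|M′|≡|N[S]| ⟨
    ∣ A ∣ + length M′  ≤⟨ +-mono-≤ (S-max A A⊆N[S] A-stable) (M-max M′ M′-matching) ⟩
    ∣ S ∣ + length M   ∎
  larger : ∀ M″ → IsMatchingIn G ⊤ M″ → length M″ ≤ length (M ++ M*-outside-N[S])
  larger M″ M″-matching = ≤-trans (M*-max M″ M″-matching)
    (length≤length-++-filter¬ _ M* M (length-filter-meets-N[S]≤ G S-stable M*-matching |N[S]|≤|S|+|M|))
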